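{- For every integer $n \ge 2$ we have $g_4(n) = 3$.
   Context: For positive integers $n$ and $k \ge 3$, $g_k(n)$ denotes the smallest integer such that for every set $A \subseteq \{1, 2, \ldots, 2n\}$ with $|A| \ge n + g_k(n)$ there exist pairwise distinct integers $b_1, \ldots, b_k$ (arbitrary integers, not required to be positive or to lie in $A$) with $b_i + b_j \in A$ for all $1 \le i < j \le k$. -}

module Defs where

open import Data.Nat using (ℕ; _≤_; _<_)
import Data.Nat
import Data.Fin
open import Data.Integer as ℤ using (ℤ; +_)
open import Data.Fin using (Fin)
open import Data.List using (List; length)
open import Data.List.Relation.Unary.All using (All)
open import Data.List.Relation.Unary.Unique.Propositional using (Unique)
open import Data.List.Membership.Propositional using (_∈_)
open import Data.Product using (Σ; _×_)
open import Function.Definitions using (Injective)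
open import Relation.Binary.PropositionalEquality using (_≡_)

record SubsetOf2n (n : ℕ) : Set where
  field
    elems  : List ℕ
    unique : Unique elems
    range  : All (λ x → 1 ≤ x × x ≤ 2 Data.Nat.* n) elems

open SubsetOf2n public

card : ∀ {n} → SubsetOf2n n → ℕ
card A = length (elems A)

_∈ᶻ_ : ∀ {n} → ℤ → SubsetOf2n n → Set
z ∈ᶻ A = Σ ℕ (λ x → (z ≡ + x) × (x ∈ elems A))

HasSumClique : ∀ {n} → ℕ → SubsetOf2n n → Set
HasSumClique k A =
  Σ (Fin k → ℤ) λ b →
    Injective _≡_ _≡_ b ×
    (∀ (i j : Fin k) → Data.Fin._<_ i j → (b i ℤ.+ b j) ∈ᶻ A)

Threshold : ℕ → ℕ → ℤ → Set
Threshold k n g = ∀ (A : SubsetOf2n n) → (+ n) ℤ.+ g ℤ.≤ + (card A) → HasSumClique k A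

IsG : ℕ → ℕ → ℤ → Set
IsG k n m = Threshold k n m × (∀ (g : ℤ) → Threshold k n g → m ℤ.≤ g)

-- Call (z, w, x, y) a configuration of A if z, z + 1, w, w + 1, x, y ∈ A, z + w is even,
-- x + y = z + w + 1 and z + 1 < x, y. Then one of x, y is odd, say x = 2t + 1, and b = (t, t + 1, z − t, w − t)
-- has the pairwise sums x, z, w, z + 1, w + 1, y. A window of 2m consecutive integers without a configuration
-- holds at most m + 2 elements of A: if one of its two end pairs holds at most one element, drop that pair;
-- otherwise the end pairs give z and w, and the m − 2 pairs of the inner window mirrored about its centre all
-- have x + y = z + w + 1, so each holds at most one element.
--
-- A = {1, 3, …, 2n − 1} ∪ {2n − 2, 2n} has n + 2 elements but only two even ones. If three of
-- b₁, …, b₄ have the same parity, their three pairwise sums are distinct and even. Otherwise the parities split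
-- 2 + 2: the two sums within the classes are even, hence ≥ 2n − 2, so the four odd sums across the classes lie
-- in {2n − 3, 2n − 1}, and this forces two of the b's to coincide.
module Submission where

open import Defs
open import Data.Nat using (ℕ; zero; suc; _+_; _*_; _≤_; _<_; z≤n; s≤s; s≤s⁻¹; z<s; s<s)
open import Data.Nat.Base using (parity; ⌊_/2⌋)
open import Data.Nat.Properties
open import Data.Nat.Tactic.RingSolver using (solve-∀)
open import Data.Integer as ℤ using (ℤ; +_; -[1+_]; _⊖_)
import Data.Integer.Properties as ℤ
import Data.Integer.Tactic.RingSolver as ℤ-Solver
open import Algebra.Properties.AbelianGroup ℤ.+-0-abelianGroup using (∙-cancelˡ; ∙-cancelʳ)
open import Data.Parity.Base as ℙ using (Parity; 0ℙ; 1ℙ; _⁻¹)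
open import Data.Parity.Properties as ℙ using (+-homo-+; p+p≡0ℙ; suc-homo-⁻¹)
open import Data.Fin as Fin using (Fin)
open import Data.Fin.Patterns using (0F; 1F; 2F; 3F)
import Data.Fin.Properties as Fin
open import Data.Bool using (if_then_else_)
open import Data.Product using (_×_; _,_; ∃)
open import Data.Sum using (_⊎_; inj₁; inj₂)
open import Data.Empty using (⊥; ⊥-elim)
open import Data.List using (List; []; _∷_; length; applyUpTo)
open import Data.List.Properties using (length-applyUpTo)
open import Data.List.Relation.Unary.All as All using (All; []; _∷_)
open import Data.List.Relation.Unary.All.Properties using (applyUpTo⁺₁)
open import Data.List.Relation.Unary.Any using (here; there)
open import Data.List.Relation.Unary.AllPairs using ([]; _∷_)
open import Data.List.Relation.Unary.Unique.Propositional using (Unique)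
import Data.List.Relation.Unary.Unique.Propositional.Properties as Unique
open import Data.List.Membership.Propositional using (_∈_)
open import Data.List.Membership.Propositional.Properties using (∈-applyUpTo⁻)
open import Data.List.Membership.DecPropositional _≟_ using (_∈?_)
open import Function using (_∘_)
open import Function.Definitions using (Injective)
open import Relation.Nullary using (¬_; Dec; yes; no; does)
open import Relation.Unary using (Decidable)
open import Relation.Binary.Definitions using (tri<; tri≈; tri>)
open import Relation.Binary.PropositionalEquality

-- Counting in windows

module _ {P : ℕ → Set} (P? : Decidable P) where

  𝟙 : ℕ → ℕ
  𝟙 x = if does (P? x) then 1 else 0

  count : ℕ → ℕ → ℕ
  count a zero    = 0
  count a (suc L) = 𝟙 a + count (suc a) L

  𝟙≤1 : ∀ x → 𝟙 x ≤ 1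
  𝟙≤1 x with P? x
  ... | yes _ = ≤-refl
  ... | no  _ = z≤n

  both-or-𝟙+𝟙≤1 : ∀ x y → P x × P y ⊎ 𝟙 x + 𝟙 y ≤ 1
  both-or-𝟙+𝟙≤1 x y with P? x | P? y
  ... | yes px | yes py = inj₁ (px , py)
  ... | yes _  | no  _  = inj₂ ≤-refl
  ... | no  _  | yes _  = inj₂ ≤-refl
  ... | no  _  | no  _  = inj₂ z≤n

  count≤length : ∀ a L → count a L ≤ L
  count≤length a zero    = z≤n
  count≤length a (suc L) = +-mono-≤ (𝟙≤1 a) (count≤length (suc a) L)

  count-snoc : ∀ a L → count a (suc L) ≡ count a L + 𝟙 (a + L)
  count-snoc a zero    = trans (+-identityʳ (𝟙 a)) (cong 𝟙 (sym (+-identityʳ a)))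
  count-snoc a (suc L) = begin
    𝟙 a + count (suc a) (suc L)             ≡⟨ cong (_+_ (𝟙 a)) (count-snoc (suc a) L) ⟩
    𝟙 a + (count (suc a) L + 𝟙 (suc a + L)) ≡⟨ +-assoc (𝟙 a) _ _ ⟨
    count a (suc L) + 𝟙 (suc a + L)         ≡⟨ cong (λ x → count a (suc L) + 𝟙 x) (+-suc a L) ⟨
    count a (suc L) + 𝟙 (a + suc L)         ∎
    where open ≡-Reasoning

  count-ends : ∀ a L → count a (suc (suc L)) ≡ count a L + (𝟙 (a + L) + 𝟙 (suc (a + L)))
  count-ends a L = begin
    count a (suc (suc L))                       ≡⟨ count-snoc a (suc L) ⟩
    count a (suc L) + 𝟙 (a + suc L)             ≡⟨ cong₂ _+_ (count-snoc a L) (cong 𝟙 (+-suc a L)) ⟩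
    count a L + 𝟙 (a + L) + 𝟙 (suc (a + L))     ≡⟨ +-assoc (count a L) _ _ ⟩
    count a L + (𝟙 (a + L) + 𝟙 (suc (a + L)))   ∎
    where open ≡-Reasoning

module _ {P Q : ℕ → Set} (P? : Decidable P) (Q? : Decidable Q) (P⊆Q : ∀ {x} → P x → Q x) where

  𝟙-mono : ∀ x → 𝟙 P? x ≤ 𝟙 Q? x
  𝟙-mono x with P? x | Q? x
  ... | yes px | no ¬qx = ⊥-elim (¬qx (P⊆Q px))
  ... | yes _  | yes _  = ≤-refl
  ... | no  _  | _      = z≤n

  count-mono : ∀ a L → count P? a L ≤ count Q? a L
  count-mono a zero    = z≤n
  count-mono a (suc L) = +-mono-≤ (𝟙-mono a) (count-mono (suc a) L)

  count-mono-< : ∀ {x} → ¬ P x → Q x → ∀ a L → a ≤ x → x < a + L → count P? a L < count Q? a L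
  count-mono-< ¬px qx a zero    a≤x x<a+0 = ⊥-elim (≤⇒≯ a≤x (subst (_ <_) (+-identityʳ a) x<a+0))
  count-mono-< {x} ¬px qx a (suc L) a≤x x<a+L with m≤n⇒m<n∨m≡n a≤x
  ... | inj₂ refl = +-mono-≤ 𝟙-strict (count-mono (suc a) L)
    where
    𝟙-strict : 𝟙 P? a < 𝟙 Q? a
    𝟙-strict with P? a | Q? a
    ... | yes px | _      = ⊥-elim (¬px px)
    ... | no  _  | yes _  = ≤-refl
    ... | no  _  | no ¬qx = ⊥-elim (¬qx qx)
  ... | inj₁ a<x = subst (_≤ count Q? a (suc L)) (+-suc (𝟙 P? a) _)
    (+-mono-≤ (𝟙-mono a) (count-mono-< ¬px qx (suc a) L a<x (subst (x <_) (+-suc a L) x<a+L)))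

length≤count : ∀ {a L xs} → Unique xs → All (λ x → a ≤ x × x < a + L) xs → length xs ≤ count (_∈? xs) a L
length≤count {xs = []}     []                    []                         = z≤n
length≤count {a} {L} {x ∷ xs} xs-unique@(_ ∷ xs′-unique) ((a≤x , x<a+L) ∷ xs′-range) =
  ≤-trans (s≤s (length≤count xs′-unique xs′-range))
    (count-mono-< (_∈? xs) (_∈? (x ∷ xs)) there (Unique.Unique[x∷xs]⇒x∉xs xs-unique) (here refl) a L a≤x x<a+L)

-- Configurations

parity-double : ∀ m → parity (m + m) ≡ 0ℙ
parity-double m = trans (+-homo-+ m m) (p+p≡0ℙ (parity m))

double-suc : ∀ m → suc m + suc m ≡ suc (suc (m + m))
double-suc m = cong suc (+-suc m m)

record Configuration (P : ℕ → Set) : Set where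
  constructor configuration
  field
    z w x y   : ℕ
    z+w-even  : parity (z + w) ≡ 0ℙ
    x+y≡1+z+w : x + y ≡ suc (z + w)
    1+z<x     : suc z < x
    1+z<y     : suc z < y
    z∈        : P z
    1+z∈      : P (suc z)
    w∈        : P w
    1+w∈      : P (suc w)
    x∈        : P x
    y∈        : P y

  x<w : x < w
  x<w = +-cancelʳ-≤ z (suc x) w (s≤s⁻¹ (begin
    suc (suc x + z)   ≡⟨ shift x z ⟩
    x + suc (suc z)   ≤⟨ +-monoʳ-≤ x 1+z<y ⟩
    x + y             ≡⟨ x+y≡1+z+w ⟩
    suc (z + w)       ≡⟨ cong suc (+-comm z w) ⟩
    suc (w + z)       ∎))
    where
    open ≤-Reasoning
    shift : ∀ x z → suc (suc x + z) ≡ x + suc (suc z)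
    shift = solve-∀

swap : ∀ {P} → Configuration P → Configuration P
swap (configuration z w x y z+w-even x+y≡1+z+w 1+z<x 1+z<y z∈ 1+z∈ w∈ 1+w∈ x∈ y∈) =
  configuration z w y x z+w-even (trans (+-comm y x) x+y≡1+z+w) 1+z<y 1+z<x z∈ 1+z∈ w∈ 1+w∈ y∈ x∈

record MirrorPair (P : ℕ → Set) (a L : ℕ) : Set where
  constructor mirrorPair
  field
    x y     : ℕ
    a≤x     : a ≤ x
    a≤y     : a ≤ y
    1+x+y≡  : suc (x + y) ≡ a + (a + L)
    x∈      : P x
    y∈      : P y

module _ {P : ℕ → Set} (P? : Decidable P) where

  mirrorPair-or-count : ∀ m a → MirrorPair P a (m + m) ⊎ count P? a (m + m) ≤ m
  mirrorPair-or-count zero    a = inj₂ z≤n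
  mirrorPair-or-count (suc m) a with mirrorPair-or-count m (suc a) | both-or-𝟙+𝟙≤1 P? a (suc a + (m + m))
  ... | inj₁ (mirrorPair x y a<x a<y 1+x+y≡ x∈ y∈) | _ =
    inj₁ (mirrorPair x y (<⇒≤ a<x) (<⇒≤ a<y) (trans 1+x+y≡ (shift a m)) x∈ y∈)
    where
    shift : ∀ a m → suc a + (suc a + (m + m)) ≡ a + (a + (suc m + suc m))
    shift = solve-∀
  ... | inj₂ _ | inj₁ (a∈ , last∈) =
    inj₁ (mirrorPair a (suc a + (m + m)) ≤-refl (≤-trans (n≤1+n a) (m≤m+n (suc a) (m + m))) (ends a m)
                     a∈ last∈)
    where
    ends : ∀ a m → suc (a + (suc a + (m + m))) ≡ a + (a + (suc m + suc m))
    ends = solve-∀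
  ... | inj₂ inner≤m | inj₂ ends≤1 = inj₂ (begin
    count P? a (suc m + suc m)
      ≡⟨ cong (count P? a) (double-suc m) ⟩
    𝟙 P? a + count P? (suc a) (suc (m + m))
      ≡⟨ cong (_+_ (𝟙 P? a)) (count-snoc P? (suc a) (m + m)) ⟩
    𝟙 P? a + (count P? (suc a) (m + m) + 𝟙 P? (suc a + (m + m)))
      ≡⟨ regroup (𝟙 P? a) _ _ ⟩
    (𝟙 P? a + 𝟙 P? (suc a + (m + m))) + count P? (suc a) (m + m)
      ≤⟨ +-mono-≤ ends≤1 inner≤m ⟩
    suc m
      ∎)
    where
    open ≤-Reasoning
    regroup : ∀ u v w → u + (v + w) ≡ (u + w) + v
    regroup = solve-∀

  module _ (m a : ℕ) where
    private
      w : ℕ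
      w = a + suc (suc (m + m))

      length≡ : suc (suc m) + suc (suc m) ≡ suc (suc (suc (suc (m + m))))
      length≡ = trans (double-suc (suc m)) (cong (suc ∘ suc) (double-suc m))

    count-by-left-end : count P? a (suc (suc m) + suc (suc m)) ≡
                        (𝟙 P? a + 𝟙 P? (suc a)) + count P? (suc (suc a)) (suc m + suc m)
    count-by-left-end = trans (cong (count P? a) (double-suc (suc m))) (sym (+-assoc (𝟙 P? a) _ _))

    count-by-right-end : count P? a (suc (suc m) + suc (suc m)) ≡
                         count P? a (suc m + suc m) + (𝟙 P? w + 𝟙 P? (suc w))
    count-by-right-end = begin
      count P? a (suc (suc m) + suc (suc m))
        ≡⟨ cong (count P? a) length≡ ⟩
      count P? a (suc (suc (suc (suc (m + m)))))
        ≡⟨ count-ends P? a (suc (suc (m + m))) ⟩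
      count P? a (suc (suc (m + m))) + (𝟙 P? w + 𝟙 P? (suc w))
        ≡⟨ cong (λ L → count P? a L + (𝟙 P? w + 𝟙 P? (suc w))) (double-suc m) ⟨
      count P? a (suc m + suc m) + (𝟙 P? w + 𝟙 P? (suc w))
        ∎
      where open ≡-Reasoning

    count≤inner+4 : count P? a (suc (suc m) + suc (suc m)) ≤ 2 + (count P? (suc (suc a)) (m + m) + 2)
    count≤inner+4 = begin
      count P? a (suc (suc m) + suc (suc m))
        ≡⟨ cong (count P? a) length≡ ⟩
      𝟙 P? a + (𝟙 P? (suc a) + count P? (suc (suc a)) (suc (suc (m + m))))
        ≡⟨ cong (λ c → 𝟙 P? a + (𝟙 P? (suc a) + c)) (count-ends P? (suc (suc a)) (m + m)) ⟩
      𝟙 P? a + (𝟙 P? (suc a) + (count P? (suc (suc a)) (m + m) + (𝟙 P? v + 𝟙 P? (suc v))))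
        ≤⟨ +-mono-≤ (𝟙≤1 P? a) (+-mono-≤ (𝟙≤1 P? (suc a))
             (+-monoʳ-≤ _ (+-mono-≤ (𝟙≤1 P? v) (𝟙≤1 P? (suc v))))) ⟩
      2 + (count P? (suc (suc a)) (m + m) + 2)
        ∎
      where
      open ≤-Reasoning
      v : ℕ
      v = suc (suc a) + (m + m)

    full-ends⇒configuration : P a → P (suc a) → P w → P (suc w) → MirrorPair P (suc (suc a)) (m + m) →
                              Configuration P
    full-ends⇒configuration a∈ 1+a∈ w∈ 1+w∈ (mirrorPair x y 2+a≤x 2+a≤y 1+x+y≡ x∈ y∈) =
      configuration a w x y (subst (λ s → parity s ≡ 0ℙ) (sym (even a m)) (parity-double (suc (a + m))))
        (suc-injective (trans 1+x+y≡ (mirror a m))) 2+a≤x 2+a≤y a∈ 1+a∈ w∈ 1+w∈ x∈ y∈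
      where
      even : ∀ a m → a + (a + suc (suc (m + m))) ≡ suc (a + m) + suc (a + m)
      even = solve-∀
      mirror : ∀ a m → suc (suc a) + (suc (suc a) + (m + m)) ≡ suc (suc (a + (a + suc (suc (m + m)))))
      mirror = solve-∀

    grow-window : count P? (suc (suc a)) (suc m + suc m) ≤ suc m + 2 → count P? a (suc m + suc m) ≤ suc m + 2 →
                  Configuration P ⊎ count P? a (suc (suc m) + suc (suc m)) ≤ suc (suc m) + 2
    grow-window right≤ left≤
      with both-or-𝟙+𝟙≤1 P? a (suc a) | both-or-𝟙+𝟙≤1 P? w (suc w) | mirrorPair-or-count m (suc (suc a))
    ... | inj₂ left-end≤1 | _ | _ =
      inj₂ (≤-trans (≤-reflexive count-by-left-end) (+-mono-≤ left-end≤1 right≤))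
    ... | _ | inj₂ right-end≤1 | _ =
      inj₂ (≤-trans (≤-reflexive count-by-right-end)
                    (≤-trans (+-mono-≤ left≤ right-end≤1) (≤-reflexive (+-comm (suc m + 2) 1))))
    ... | inj₁ (a∈ , 1+a∈) | inj₁ (w∈ , 1+w∈) | inj₁ pair =
      inj₁ (full-ends⇒configuration a∈ 1+a∈ w∈ 1+w∈ pair)
    ... | inj₁ _ | inj₁ _ | inj₂ inner≤m = inj₂ (≤-trans count≤inner+4 (+-monoʳ-≤ 2 (+-monoˡ-≤ 2 inner≤m)))

  configuration-or-count : ∀ m a → Configuration P ⊎ count P? a (m + m) ≤ m + 2
  configuration-or-count zero          a = inj₂ z≤n
  configuration-or-count (suc zero)    a = inj₂ (m≤n⇒m≤1+n (count≤length P? a 2))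
  configuration-or-count (suc (suc m)) a
    with configuration-or-count (suc m) (suc (suc a)) | configuration-or-count (suc m) a
  ... | inj₁ c      | _          = inj₁ c
  ... | inj₂ _      | inj₁ c     = inj₁ c
  ... | inj₂ right≤ | inj₂ left≤ = grow-window m a right≤ left≤

-- Parity of integers

parityℤ : ℤ → Parity
parityℤ (+ n)    = parity n
parityℤ -[1+ n ] = parity (suc n)

⁻¹+⁻¹≡+ : ∀ p q → p ⁻¹ ℙ.+ q ⁻¹ ≡ p ℙ.+ q
⁻¹+⁻¹≡+ 0ℙ 0ℙ = refl
⁻¹+⁻¹≡+ 0ℙ 1ℙ = refl
⁻¹+⁻¹≡+ 1ℙ 0ℙ = refl
⁻¹+⁻¹≡+ 1ℙ 1ℙ = refl

parity-suc-+-parity-suc : ∀ m n → parity (suc m) ℙ.+ parity (suc n) ≡ parity m ℙ.+ parity n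
parity-suc-+-parity-suc m n = begin
  parity (suc m) ℙ.+ parity (suc n)         ≡⟨ ⁻¹+⁻¹≡+ (parity (suc m)) (parity (suc n)) ⟨
  parity (suc m) ⁻¹ ℙ.+ parity (suc n) ⁻¹   ≡⟨ cong₂ ℙ._+_ (suc-homo-⁻¹ m) (suc-homo-⁻¹ n) ⟩
  parity m ℙ.+ parity n                     ∎
  where open ≡-Reasoning

parityℤ-⊖ : ∀ m n → parityℤ (m ⊖ n) ≡ parity m ℙ.+ parity n
parityℤ-⊖ m       zero    = sym (ℙ.+-identityʳ (parity m))
parityℤ-⊖ zero    (suc n) = refl
parityℤ-⊖ (suc m) (suc n) = begin
  parityℤ (suc m ⊖ suc n)              ≡⟨ cong parityℤ (ℤ.[1+m]⊖[1+n]≡m⊖n m n) ⟩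
  parityℤ (m ⊖ n)                      ≡⟨ parityℤ-⊖ m n ⟩
  parity m ℙ.+ parity n                ≡⟨ parity-suc-+-parity-suc m n ⟨
  parity (suc m) ℙ.+ parity (suc n)    ∎
  where open ≡-Reasoning

parityℤ-homo-+ : ∀ i j → parityℤ (i ℤ.+ j) ≡ parityℤ i ℙ.+ parityℤ j
parityℤ-homo-+ (+ m)    (+ n)    = +-homo-+ m n
parityℤ-homo-+ (+ m)    -[1+ n ] = parityℤ-⊖ m (suc n)
parityℤ-homo-+ -[1+ m ] (+ n)    = trans (parityℤ-⊖ n (suc m)) (ℙ.+-comm (parity n) (parity (suc m)))
parityℤ-homo-+ -[1+ m ] -[1+ n ] = trans (+-homo-+ m n) (sym (parity-suc-+-parity-suc m n))

parity≡1ℙ⇒odd : ∀ x → parity x ≡ 1ℙ → ∃ λ t → x ≡ suc (t + t)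
parity≡1ℙ⇒odd (suc zero)    _     = 0 , refl
parity≡1ℙ⇒odd (suc (suc x)) x-odd with parity≡1ℙ⇒odd x x-odd
... | t , refl = suc t , cong (suc ∘ suc) (sym (+-suc t t))

-- Sum cliques from configurations

fin4-pairs : ∀ {ℓ} {R : Fin 4 → Fin 4 → Set ℓ} → R 0F 1F → R 0F 2F → R 0F 3F → R 1F 2F → R 1F 3F → R 2F 3F →
             ∀ i j → i Fin.< j → R i j
fin4-pairs r01 _   _   _   _   _   0F 1F _ = r01
fin4-pairs _   r02 _   _   _   _   0F 2F _ = r02
fin4-pairs _   _   r03 _   _   _   0F 3F _ = r03
fin4-pairs _   _   _   r12 _   _   1F 2F _ = r12
fin4-pairs _   _   _   _   r13 _   1F 3F _ = r13
fin4-pairs _   _   _   _   _   r23 2F 3F _ = r23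
fin4-pairs _   _   _   _   _   _   _                     0F ()
fin4-pairs _   _   _   _   _   _   (Fin.suc _)           1F (s≤s ())
fin4-pairs _   _   _   _   _   _   (Fin.suc (Fin.suc _)) 2F (s≤s (s≤s ()))
fin4-pairs _   _   _   _   _   _   3F                    3F (s≤s (s≤s (s≤s ())))

<-distinct⇒injective : ∀ {n} {A : Set} (f : Fin n → A) → (∀ i j → i Fin.< j → f i ≢ f j) → Injective _≡_ _≡_ f
<-distinct⇒injective f distinct {i} {j} fi≡fj with Fin.<-cmp i j
... | tri< i<j _ _ = ⊥-elim (distinct i j i<j fi≡fj)
... | tri≈ _ i≡j _ = i≡j
... | tri> _ _ j<i = ⊥-elim (distinct j i j<i (sym fi≡fj))

≡⇒values≡ : ∀ {u v : ℤ} {p q} → u ≡ v → u ≡ + p → v ≡ + q → p ≡ q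
≡⇒values≡ refl refl refl = refl

module SumWitness (t z w : ℕ) where

  b : Fin 4 → ℤ
  b 0F = + t
  b 1F = + suc t
  b 2F = + z ℤ.- + t
  b 3F = + w ℤ.- + t

  private
    add-sub : ∀ i j → i ℤ.+ (j ℤ.- i) ≡ j
    add-sub = ℤ-Solver.solve-∀
    suc-add-sub : ∀ i j → (ℤ.1ℤ ℤ.+ i) ℤ.+ (j ℤ.- i) ≡ ℤ.1ℤ ℤ.+ j
    suc-add-sub = ℤ-Solver.solve-∀
    sub-add-sub : ∀ i j k → (j ℤ.- i) ℤ.+ (k ℤ.- i) ≡ (j ℤ.+ k) ℤ.- (i ℤ.+ i)
    sub-add-sub = ℤ-Solver.solve-∀
    add-sub-cancel : ∀ i j → (i ℤ.+ j) ℤ.- i ≡ j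
    add-sub-cancel = ℤ-Solver.solve-∀

  b₀+b₁ : b 0F ℤ.+ b 1F ≡ + suc (t + t)
  b₀+b₁ = cong +_ (+-suc t t)

  b₀+b₂ : b 0F ℤ.+ b 2F ≡ + z
  b₀+b₂ = add-sub (+ t) (+ z)

  b₀+b₃ : b 0F ℤ.+ b 3F ≡ + w
  b₀+b₃ = add-sub (+ t) (+ w)

  b₁+b₂ : b 1F ℤ.+ b 2F ≡ + suc z
  b₁+b₂ = suc-add-sub (+ t) (+ z)

  b₁+b₃ : b 1F ℤ.+ b 3F ≡ + suc w
  b₁+b₃ = suc-add-sub (+ t) (+ w)

  b₂+b₃ : ∀ {y} → t + t + y ≡ z + w → b 2F ℤ.+ b 3F ≡ + y
  b₂+b₃ {y} 2t+y≡z+w = begin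
    (+ z ℤ.- + t) ℤ.+ (+ w ℤ.- + t)   ≡⟨ sub-add-sub (+ t) (+ z) (+ w) ⟩
    + (z + w) ℤ.- + (t + t)           ≡⟨ cong (λ s → + s ℤ.- + (t + t)) 2t+y≡z+w ⟨
    + (t + t + y) ℤ.- + (t + t)       ≡⟨ add-sub-cancel (+ (t + t)) (+ y) ⟩
    + y                               ∎
    where open ≡-Reasoning

module _ {n} (A : SubsetOf2n n) where

  odd-configuration⇒clique : ∀ (c : Configuration (_∈ elems A)) t → Configuration.x c ≡ suc (t + t) →
                             HasSumClique 4 A
  odd-configuration⇒clique c@(configuration z w x y _ x+y≡1+z+w 1+z<x _ z∈ 1+z∈ w∈ 1+w∈ x∈ y∈) t refl =
    b , <-distinct⇒injective b (fin4-pairs b₀≢b₁ b₀≢b₂ b₀≢b₃ b₁≢b₂ b₁≢b₃ b₂≢b₃) ,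
    fin4-pairs (x , b₀+b₁ , x∈) (z , b₀+b₂ , z∈) (w , b₀+b₃ , w∈) (suc z , b₁+b₂ , 1+z∈) (suc w , b₁+b₃ , 1+w∈)
               (y , b₂+b₃ (suc-injective x+y≡1+z+w) , y∈)
    where
    open SumWitness t z w

    z<x : z < x
    z<x = <-trans (n<1+n z) 1+z<x
    x<w : x < w
    x<w = Configuration.x<w c

    b₀≢b₁ : b 0F ≢ b 1F
    b₀≢b₁ e = 1+n≢n (sym (≡⇒values≡ (cong (ℤ._+ b 2F) e) b₀+b₂ b₁+b₂))
    b₀≢b₂ : b 0F ≢ b 2F
    b₀≢b₂ e = >⇒≢ 1+z<x (≡⇒values≡ (trans (cong (ℤ._+ b 1F) e) (ℤ.+-comm (b 2F) (b 1F))) b₀+b₁ b₁+b₂)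
    b₀≢b₃ : b 0F ≢ b 3F
    b₀≢b₃ e = <⇒≢ (m<n⇒m<1+n x<w)
                  (≡⇒values≡ (trans (cong (ℤ._+ b 1F) e) (ℤ.+-comm (b 3F) (b 1F))) b₀+b₁ b₁+b₃)
    b₁≢b₂ : b 1F ≢ b 2F
    b₁≢b₂ e = >⇒≢ z<x (≡⇒values≡ (cong (ℤ._+_ (b 0F)) e) b₀+b₁ b₀+b₂)
    b₁≢b₃ : b 1F ≢ b 3F
    b₁≢b₃ e = <⇒≢ x<w (≡⇒values≡ (cong (ℤ._+_ (b 0F)) e) b₀+b₁ b₀+b₃)
    b₂≢b₃ : b 2F ≢ b 3F
    b₂≢b₃ e = <⇒≢ (<-trans z<x x<w) (≡⇒values≡ (cong (ℤ._+_ (b 0F)) e) b₀+b₂ b₀+b₃)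

  configuration⇒clique : Configuration (_∈ elems A) → HasSumClique 4 A
  configuration⇒clique c with parity (Configuration.x c) in x-parity
  ... | 1ℙ = let t , x≡ = parity≡1ℙ⇒odd _ x-parity in odd-configuration⇒clique c t x≡
  ... | 0ℙ = let t , y≡ = parity≡1ℙ⇒odd _ y-odd in odd-configuration⇒clique (swap c) t y≡
    where
    open Configuration c
    y-odd : parity y ≡ 1ℙ
    y-odd = begin
      parity y                  ≡⟨ cong (ℙ._+ parity y) x-parity ⟨
      parity x ℙ.+ parity y     ≡⟨ +-homo-+ x y ⟨
      parity (x + y)            ≡⟨ cong parity x+y≡1+z+w ⟩
      parity (1 + (z + w))      ≡⟨ +-homo-+ 1 (z + w) ⟩
      1ℙ ℙ.+ parity (z + w)     ≡⟨ cong (1ℙ ℙ.+_) z+w-even ⟩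
      1ℙ                        ∎
      where open ≡-Reasoning

2*n≡n+n : ∀ n → 2 * n ≡ n + n
2*n≡n+n n = cong (_+_ n) (+-identityʳ n)

large-set⇒clique : ∀ {n} (A : SubsetOf2n n) → n + 3 ≤ card A → HasSumClique 4 A
large-set⇒clique {n} A n+3≤|A| with configuration-or-count (_∈? elems A) n 1
... | inj₁ c         = configuration⇒clique A c
... | inj₂ count≤n+2 = ⊥-elim (≤⇒≯ (≤-trans n+3≤|A| (≤-trans |A|≤count count≤n+2)) (+-monoʳ-< n (n<1+n 2)))
  where
  in-window : ∀ {x} → 1 ≤ x × x ≤ 2 * n → 1 ≤ x × x < 1 + (n + n)
  in-window (1≤x , x≤2n) = 1≤x , s≤s (≤-trans x≤2n (≤-reflexive (2*n≡n+n n)))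

  |A|≤count : card A ≤ count (_∈? elems A) 1 (n + n)
  |A|≤count = length≤count (unique A) (All.map in-window (range A))

-- The extremal set

two-values : ∀ {A : Set} {u v x y z : A} → x ≡ u ⊎ x ≡ v → y ≡ u ⊎ y ≡ v → z ≡ u ⊎ z ≡ v →
             x ≢ z → y ≢ z → x ≡ y
two-values (inj₁ refl) (inj₁ refl) _           _   _   = refl
two-values (inj₂ refl) (inj₂ refl) _           _   _   = refl
two-values (inj₁ refl) (inj₂ refl) (inj₁ refl) x≢z _   = ⊥-elim (x≢z refl)
two-values (inj₁ refl) (inj₂ refl) (inj₂ refl) _   y≢z = ⊥-elim (y≢z refl)
two-values (inj₂ refl) (inj₁ refl) (inj₁ refl) _   y≢z = ⊥-elim (y≢z refl)
two-values (inj₂ refl) (inj₁ refl) (inj₂ refl) x≢z _   = ⊥-elim (x≢z refl)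

parity-cases : ∀ p → p ≡ 0ℙ ⊎ p ≡ 1ℙ
parity-cases 0ℙ = inj₁ refl
parity-cases 1ℙ = inj₂ refl

same-parity : ∀ {p q r : Parity} → p ≢ r → q ≢ r → p ≡ q
same-parity = two-values (parity-cases _) (parity-cases _) (parity-cases _)

≢⇒+≡1ℙ : ∀ {p q} → p ≢ q → p ℙ.+ q ≡ 1ℙ
≢⇒+≡1ℙ {0ℙ} {0ℙ} p≢q = ⊥-elim (p≢q refl)
≢⇒+≡1ℙ {0ℙ} {1ℙ} _   = refl
≢⇒+≡1ℙ {1ℙ} {0ℙ} _   = refl
≢⇒+≡1ℙ {1ℙ} {1ℙ} p≢q = ⊥-elim (p≢q refl)

parity-odd : ∀ i → parity (suc (i + i)) ≡ 1ℙ
parity-odd i = trans (+-homo-+ 1 (i + i)) (cong (1ℙ ℙ.+_) (parity-double i))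

double-injective : ∀ {m n} → m + m ≡ n + n → m ≡ n
double-injective {m} {n} e = trans (n≡⌊n+n/2⌋ m) (trans (cong ⌊_/2⌋ e) (sym (n≡⌊n+n/2⌋ n)))

between-skipping-middle : ∀ {j p} → j ≤ p → p ≤ suc (suc j) → p ≢ suc j → p ≡ j ⊎ p ≡ suc (suc j)
between-skipping-middle j≤p p≤2+j p≢1+j with m≤n⇒m<n∨m≡n j≤p
... | inj₂ j≡p = inj₁ (sym j≡p)
... | inj₁ j<p with m≤n⇒m<n∨m≡n j<p
...   | inj₂ 1+j≡p = ⊥-elim (p≢1+j (sym 1+j≡p))
...   | inj₁ 1+j<p = inj₂ (≤-antisym p≤2+j 1+j<p)

no-crossed-pairs : ∀ {u v p q r s : ℕ} → p ≡ u ⊎ p ≡ v → q ≡ u ⊎ q ≡ v → r ≡ u ⊎ r ≡ v → s ≡ u ⊎ s ≡ v →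
                   p + q ≡ r + s → p ≢ r → q ≢ r → s ≢ p → ⊥
no-crossed-pairs {p = p} {q} {r} {s} p∈ q∈ r∈ s∈ p+q≡r+s p≢r q≢r s≢p = p≢r (double-injective (begin
  p + p   ≡⟨ cong (_+_ p) (two-values p∈ q∈ r∈ p≢r q≢r) ⟩
  p + q   ≡⟨ p+q≡r+s ⟩
  r + s   ≡⟨ cong (_+_ r) (two-values r∈ s∈ p∈ (≢-sym p≢r) s≢p) ⟨
  r + r   ∎))
  where open ≡-Reasoning

sum-parity : ∀ x y {s} → x ℤ.+ y ≡ + s → parity s ≡ parityℤ x ℙ.+ parityℤ y
sum-parity x y x+y≡s = trans (cong parityℤ (sym x+y≡s)) (parityℤ-homo-+ x y)

even-sum : ∀ x y {s} → x ℤ.+ y ≡ + s → parityℤ y ≡ parityℤ x → parity s ≡ 0ℙ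
even-sum x y x+y≡s py≡px = trans (sum-parity x y x+y≡s) (trans (cong (parityℤ x ℙ.+_) py≡px) (p+p≡0ℙ (parityℤ x)))

odd-sum : ∀ x y {s} → x ℤ.+ y ≡ + s → parityℤ x ≢ parityℤ y → parity s ≡ 1ℙ
odd-sum x y x+y≡s px≢py = trans (sum-parity x y x+y≡s) (≢⇒+≡1ℙ px≢py)

values≡⇒≡ : ∀ {x y : ℤ} {u v} → x ≡ + u → y ≡ + v → u ≡ v → x ≡ y
values≡⇒≡ x≡u y≡v u≡v = trans x≡u (trans (cong +_ u≡v) (sym y≡v))

sum-exchange : ∀ a b c d {e e′ p q} → a ℤ.+ b ≡ + e → c ℤ.+ d ≡ + e′ → a ℤ.+ c ≡ + p → b ℤ.+ d ≡ + q →
               p + q ≡ e + e′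
sum-exchange a b c d a+b≡e c+d≡e′ a+c≡p b+d≡q =
  ℤ.+-injective (trans (sym (cong₂ ℤ._+_ a+c≡p b+d≡q)) (trans (exchange a b c d) (cong₂ ℤ._+_ a+b≡e c+d≡e′)))
  where
  exchange : ∀ (a b c d : ℤ) → (a ℤ.+ c) ℤ.+ (b ℤ.+ d) ≡ (a ℤ.+ b) ℤ.+ (c ℤ.+ d)
  exchange = ℤ-Solver.solve-∀

module Extremal (k : ℕ) where

  n j : ℕ
  n = suc (suc k)
  j = k + suc k

  odd : ℕ → ℕ
  odd i = suc (i + i)

  odds : List ℕ
  odds = applyUpTo odd n

  -- {2n, 2n − 2} ∪ {1, 3, …, 2n − 1}; the odd elements j and 2 + j neighbour 2n − 2 = suc j.
  elements : List ℕ
  elements = n + n ∷ suc j ∷ odds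

  odds-odd : ∀ {x} → x ∈ odds → parity x ≡ 1ℙ
  odds-odd x∈ with ∈-applyUpTo⁻ odd x∈
  ... | i , _ , refl = parity-odd i

  even∉odds : ∀ {x} → parity x ≡ 0ℙ → All (x ≢_) odds
  even∉odds x-even = All.tabulate λ y∈ x≡y → 0ℙ≢1ℙ (trans (sym x-even) (trans (cong parity x≡y) (odds-odd y∈)))
    where
    0ℙ≢1ℙ : 0ℙ ≢ 1ℙ
    0ℙ≢1ℙ ()

  1+j<n+n : suc j < n + n
  1+j<n+n = +-mono-< (n<1+n (suc k)) (n<1+n (suc k))

  extremal : SubsetOf2n n
  extremal = record
    { elems  = elements
    ; unique = (>⇒≢ 1+j<n+n ∷ even∉odds (parity-double n)) ∷ even∉odds (parity-double (suc k))
             ∷ Unique.applyUpTo⁺₁ odd n (λ i<i′ _ e → <⇒≢ i<i′ (double-injective (suc-injective e)))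
    ; range  = (s≤s z≤n , n+n≤2n) ∷ (s≤s z≤n , ≤-trans (<⇒≤ 1+j<n+n) n+n≤2n)
             ∷ applyUpTo⁺₁ odd n (λ i<n → s≤s z≤n , ≤-trans (+-mono-≤ i<n (<⇒≤ i<n)) n+n≤2n)
    }
    where
    n+n≤2n : n + n ≤ 2 * n
    n+n≤2n = ≤-reflexive (sym (2*n≡n+n n))

  card-extremal : card extremal ≡ n + 2
  card-extremal = trans (cong (_+_ 2) (length-applyUpTo odd n)) (+-comm 2 n)

  even-member : ∀ {x} → x ∈ elements → parity x ≡ 0ℙ → x ≡ suc j ⊎ x ≡ n + n
  even-member (here refl)         _      = inj₂ refl
  even-member (there (here refl)) _      = inj₁ refl
  even-member (there (there x∈))  x-even with () ← trans (sym x-even) (odds-odd x∈)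

  even-member-≥ : ∀ {x} → x ∈ elements → parity x ≡ 0ℙ → suc j ≤ x
  even-member-≥ x∈ x-even with even-member x∈ x-even
  ... | inj₁ refl = ≤-refl
  ... | inj₂ refl = <⇒≤ 1+j<n+n

  odd-member-≤ : ∀ {x} → x ∈ elements → parity x ≡ 1ℙ → x ≤ suc (suc j)
  odd-member-≤ (here refl)         x-odd with () ← trans (sym (parity-double n)) x-odd
  odd-member-≤ (there (here refl)) x-odd with () ← trans (sym (parity-double (suc k))) x-odd
  odd-member-≤ (there (there x∈))  _     with ∈-applyUpTo⁻ odd x∈
  ... | i , s≤s i≤1+k , refl = s≤s (+-mono-≤ i≤1+k i≤1+k)

  odd-near-top : ∀ {p q} → p ∈ elements → q ∈ elements → parity p ≡ 1ℙ → parity q ≡ 1ℙ →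
                 suc j + suc j ≤ p + q → p ≡ j ⊎ p ≡ suc (suc j)
  odd-near-top {p} {q} p∈ q∈ p-odd q-odd 2+2j≤p+q = between-skipping-middle j≤p (odd-member-≤ p∈ p-odd) p≢1+j
    where
    j≤p : j ≤ p
    j≤p = s≤s⁻¹ (+-cancelʳ-≤ (suc j) (suc j) (suc p) (begin
      suc j + suc j       ≤⟨ 2+2j≤p+q ⟩
      p + q               ≤⟨ +-monoʳ-≤ p (odd-member-≤ q∈ q-odd) ⟩
      p + suc (suc j)     ≡⟨ +-suc p (suc j) ⟩
      suc p + suc j       ∎))
      where open ≤-Reasoning
    p≢1+j : p ≢ suc j
    p≢1+j refl with () ← trans (sym (parity-double (suc k))) p-odd

  no-monochromatic-triangle : ∀ {a b c} → a ≢ b → a ≢ c → b ≢ c → parityℤ b ≡ parityℤ a → parityℤ c ≡ parityℤ a →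
                              (a ℤ.+ b) ∈ᶻ extremal → (a ℤ.+ c) ∈ᶻ extremal → (b ℤ.+ c) ∈ᶻ extremal → ⊥
  no-monochromatic-triangle {a} {b} {c} a≢b a≢c b≢c pb≡pa pc≡pa
    (u , a+b≡u , u∈) (v , a+c≡v , v∈) (w , b+c≡w , w∈) =
    u≢v (two-values (even-member u∈ (even-sum a b a+b≡u pb≡pa)) (even-member v∈ (even-sum a c a+c≡v pc≡pa))
                    (even-member w∈ (even-sum b c b+c≡w (trans pc≡pa (sym pb≡pa)))) u≢w v≢w)
    where
    u≢v : u ≢ v
    u≢v u≡v = b≢c (∙-cancelˡ a b c (values≡⇒≡ a+b≡u a+c≡v u≡v))
    u≢w : u ≢ w
    u≢w u≡w = a≢c (∙-cancelʳ b a c (trans (values≡⇒≡ a+b≡u b+c≡w u≡w) (ℤ.+-comm b c)))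
    v≢w : v ≢ w
    v≢w v≡w = a≢b (∙-cancelʳ c a b (values≡⇒≡ a+c≡v b+c≡w v≡w))

  no-balanced-split : ∀ {a b c d} → a ≢ b → c ≢ d → parityℤ b ≡ parityℤ a → parityℤ d ≡ parityℤ c →
                      parityℤ a ≢ parityℤ c → (a ℤ.+ b) ∈ᶻ extremal → (c ℤ.+ d) ∈ᶻ extremal →
                      (a ℤ.+ c) ∈ᶻ extremal → (b ℤ.+ d) ∈ᶻ extremal →
                      (a ℤ.+ d) ∈ᶻ extremal → (b ℤ.+ c) ∈ᶻ extremal → ⊥
  no-balanced-split {a} {b} {c} {d} a≢b c≢d pb≡pa pd≡pc pa≢pc
    (e , a+b≡e , e∈) (e′ , c+d≡e′ , e′∈) (p , a+c≡p , p∈) (q , b+d≡q , q∈)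
    (r , a+d≡r , r∈) (s , b+c≡s , s∈) =
    no-crossed-pairs (near-top p∈ q∈ p-odd q-odd p+q≡e+e′) (near-top q∈ p∈ q-odd p-odd (trans (+-comm q p) p+q≡e+e′))
                     (near-top r∈ s∈ r-odd s-odd r+s≡e+e′) (near-top s∈ r∈ s-odd r-odd (trans (+-comm s r) r+s≡e+e′))
                     (trans p+q≡e+e′ (sym r+s≡e+e′)) p≢r q≢r s≢p
    where
    cross-odd : ∀ x y {t} → parityℤ x ≡ parityℤ a → parityℤ y ≡ parityℤ c → x ℤ.+ y ≡ + t → parity t ≡ 1ℙ
    cross-odd x y px≡pa py≡pc x+y≡t = odd-sum x y x+y≡t λ px≡py → pa≢pc (trans (sym px≡pa) (trans px≡py py≡pc))

    p-odd : parity p ≡ 1ℙ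
    p-odd = cross-odd a c refl refl a+c≡p
    q-odd : parity q ≡ 1ℙ
    q-odd = cross-odd b d pb≡pa pd≡pc b+d≡q
    r-odd : parity r ≡ 1ℙ
    r-odd = cross-odd a d refl pd≡pc a+d≡r
    s-odd : parity s ≡ 1ℙ
    s-odd = cross-odd b c pb≡pa refl b+c≡s

    p+q≡e+e′ : p + q ≡ e + e′
    p+q≡e+e′ = sum-exchange a b c d a+b≡e c+d≡e′ a+c≡p b+d≡q
    r+s≡e+e′ : r + s ≡ e + e′
    r+s≡e+e′ = sum-exchange a b d c a+b≡e (trans (ℤ.+-comm d c) c+d≡e′) a+d≡r b+c≡s

    near-top : ∀ {x y} → x ∈ elements → y ∈ elements → parity x ≡ 1ℙ → parity y ≡ 1ℙ → x + y ≡ e + e′ →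
               x ≡ j ⊎ x ≡ suc (suc j)
    near-top x∈ y∈ x-odd y-odd x+y≡e+e′ = odd-near-top x∈ y∈ x-odd y-odd (subst (suc j + suc j ≤_) (sym x+y≡e+e′)
      (+-mono-≤ (even-member-≥ e∈ (even-sum a b a+b≡e pb≡pa))
                (even-member-≥ e′∈ (even-sum c d c+d≡e′ pd≡pc))))

    p≢r : p ≢ r
    p≢r p≡r = c≢d (∙-cancelˡ a c d (values≡⇒≡ a+c≡p a+d≡r p≡r))
    q≢r : q ≢ r
    q≢r q≡r = a≢b (sym (∙-cancelʳ d b a (values≡⇒≡ b+d≡q a+d≡r q≡r)))
    s≢p : s ≢ p
    s≢p s≡p = a≢b (sym (∙-cancelʳ c b a (values≡⇒≡ b+c≡s a+c≡p s≡p)))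

  extremal-free : ¬ HasSumClique 4 extremal
  extremal-free (b , b-injective , b-sums) = by-parities (π 1F ℙ.≟ π 0F) (π 2F ℙ.≟ π 0F) (π 3F ℙ.≟ π 0F)
    where
    π : Fin 4 → Parity
    π i = parityℤ (b i)

    b≢ : ∀ {i i′} → i ≢ i′ → b i ≢ b i′
    b≢ i≢i′ bi≡bi′ = i≢i′ (b-injective bi≡bi′)

    flip : ∀ i i′ → (b i ℤ.+ b i′) ∈ᶻ extremal → (b i′ ℤ.+ b i) ∈ᶻ extremal
    flip i i′ = subst (_∈ᶻ extremal) (ℤ.+-comm (b i) (b i′))

    s01 : (b 0F ℤ.+ b 1F) ∈ᶻ extremal
    s01 = b-sums 0F 1F z<s
    s02 : (b 0F ℤ.+ b 2F) ∈ᶻ extremal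
    s02 = b-sums 0F 2F z<s
    s03 : (b 0F ℤ.+ b 3F) ∈ᶻ extremal
    s03 = b-sums 0F 3F z<s
    s12 : (b 1F ℤ.+ b 2F) ∈ᶻ extremal
    s12 = b-sums 1F 2F (s<s z<s)
    s13 : (b 1F ℤ.+ b 3F) ∈ᶻ extremal
    s13 = b-sums 1F 3F (s<s z<s)
    s23 : (b 2F ℤ.+ b 3F) ∈ᶻ extremal
    s23 = b-sums 2F 3F (s<s (s<s z<s))

    by-parities : Dec (π 1F ≡ π 0F) → Dec (π 2F ≡ π 0F) → Dec (π 3F ≡ π 0F) → ⊥
    by-parities (yes π1≡π0) (yes π2≡π0) _ =
      no-monochromatic-triangle (b≢ λ ()) (b≢ λ ()) (b≢ λ ()) π1≡π0 π2≡π0 s01 s02 s12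
    by-parities (yes π1≡π0) (no _) (yes π3≡π0) =
      no-monochromatic-triangle (b≢ λ ()) (b≢ λ ()) (b≢ λ ()) π1≡π0 π3≡π0 s01 s03 s13
    by-parities (no _) (yes π2≡π0) (yes π3≡π0) =
      no-monochromatic-triangle (b≢ λ ()) (b≢ λ ()) (b≢ λ ()) π2≡π0 π3≡π0 s02 s03 s23
    by-parities (no π1≢π0) (no π2≢π0) (no π3≢π0) =
      no-monochromatic-triangle (b≢ λ ()) (b≢ λ ()) (b≢ λ ())
        (same-parity π2≢π0 π1≢π0) (same-parity π3≢π0 π1≢π0) s12 s13 s23
    by-parities (yes π1≡π0) (no π2≢π0) (no π3≢π0) =
      no-balanced-split (b≢ λ ()) (b≢ λ ()) π1≡π0 (same-parity π3≢π0 π2≢π0) (≢-sym π2≢π0)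
        s01 s23 s02 s13 s03 s12
    by-parities (no π1≢π0) (yes π2≡π0) (no π3≢π0) =
      no-balanced-split (b≢ λ ()) (b≢ λ ()) π2≡π0 (same-parity π3≢π0 π1≢π0) (≢-sym π1≢π0)
        s02 s13 s01 s23 s03 (flip 1F 2F s12)
    by-parities (no π1≢π0) (no π2≢π0) (yes π3≡π0) =
      no-balanced-split (b≢ λ ()) (b≢ λ ()) π3≡π0 (same-parity π2≢π0 π1≢π0) (≢-sym π1≢π0)
        s03 s12 s01 (flip 2F 3F s23) s02 (flip 1F 3F s13)

theorem4 : ∀ (n : ℕ) → 2 ≤ n → IsG 4 n (+ 3)
theorem4 (suc (suc k)) (s≤s (s≤s z≤n)) = threshold , minimal
  where
  open Extremal k using (n; extremal; card-extremal; extremal-free)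

  threshold : Threshold 4 n (+ 3)
  threshold A (ℤ.+≤+ n+3≤|A|) = large-set⇒clique A n+3≤|A|

  minimal : ∀ g → Threshold 4 n g → + 3 ℤ.≤ g
  minimal g g-threshold = ℤ.≮⇒≥ λ g<3 → extremal-free (g-threshold extremal (begin
    + n ℤ.+ g        ≤⟨ ℤ.+-monoʳ-≤ (+ n) (ℤ.i<j⇒i≤pred[j] g<3) ⟩
    + (n + 2)        ≡⟨ cong +_ card-extremal ⟨
    + card extremal  ∎))
    where open ℤ.≤-Reasoning
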